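{- Let $\lambda,\mu$ be partitions with nonnegative parts and at most $n$ parts, and let $T$ be a $\mu$-dominant tableau of shape $\lambda$. Then $R(T,b_\mu)=T$ (as Gelfand–Tsetlin patterns).
   Context: Tableaux have entries in $\{1,\dots,n\}$, rows weakly increasing and columns strictly increasing. A tableau $T$ of shape $\lambda$ is identified with the Gelfand–Tsetlin pattern $T(i,j)=\#\{\text{entries}\le i\text{ in row }j\text{ of }T\}$, $1\le j\le i\le n$. Crystal structure on tableaux: for $1\le i\le n-1$ let $h_i(j)=\#\{i+1\text{ in columns}\ge j\}-\#\{i\text{ in columns}\ge j\}$, with $h_i(\infty)=0$; then $\varepsilon_i(T)=\max_jh_i(j)$. $T$ is $\mu$-dominant if $\varepsilon_i(T)\le\mu_i-\mu_{i+1}$ for all $1\le i\le n-1$. $b_\mu$ is the tableau of shape $\mu$ whose $r$-th row consists only of entries $r$. Recording tableau: for tableaux $T$ of shape $\lambda$ and $U$ of shape $\mu$, define tableaux $J^n,J^{n-1},\dots,J^0$ by $J^n=T$ and $J^{k-1}=((J^k\leftarrow a_1)\leftarrow\cdots)\leftarrow a_l$, where $a_1\le\dots\le a_l$ are the entries of row $k$ of $U$ and $\leftarrow$ is Schensted row insertion (equivalently, $J^k$ is the straight-shape part obtained when performing jeu de taquin on the skew tableau with $U$ placed up and to the right of $T$, after sliding the empty boxes to the left of rows $>k$ of $U$). Let $\lambda^k$ be the shape of $J^k$. Then $R(T,U)$ is the array $R(T,U)(i,j)=\sum_{r\ge j}\lambda^{i-j+1}_r-\sum_{r\ge j+1}\lambda^{i-j}_r$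 for $1\le j\le i\le n$. -}

module Defs where

open import Data.Nat using (ℕ; zero; suc; _≤_; _<_; _≥_; _<ᵇ_; _≡ᵇ_; _≤ᵇ_; _∸_)
open import Data.Bool using (Bool; true; false; if_then_else_)
open import Data.List using (List; []; _∷_; [_]; length; map; drop; replicate; foldl; foldr; filterᵇ; upTo; applyUpTo)
open import Data.List.Relation.Unary.All using (All)
open import Data.List.Relation.Unary.Linked using (Linked)
open import Data.Nat.ListAction using (sum)
open import Data.Maybe using (Maybe; just; nothing)
open import Data.Product using (_×_; _,_)
open import Data.Integer using (ℤ; +_; _-_; _⊔_; 0ℤ)

nth : {A : Set} → A → List A → ℕ → A
nth d []       _       = d
nth d (x ∷ xs) zero    = x
nth d (x ∷ xs) (suc k) = nth d xs k

-- Partitions with at most n parts: a list of exactly n weakly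
-- decreasing natural numbers (trailing zeros allowed).

IsPartition : ℕ → List ℕ → Set
IsPartition n la = (length la Eq.≡ n) × Linked _≥_ la
  where import Relation.Binary.PropositionalEquality as Eq

-- 1-based part  λ_r  (0 beyond the list)
part : List ℕ → ℕ → ℕ
part la r = nth 0 la (r ∸ 1)

-- Tableaux: a list of rows (row 1 first).

Tableau : Set
Tableau = List (List ℕ)

-- 1-based row j of T (empty beyond the last row)
rowOf : Tableau → ℕ → List ℕ
rowOf T j = nth [] T (j ∸ 1)

IsTableau : ℕ → List ℕ → Tableau → Set
IsTableau n la T =
    All (All (λ x → (1 ≤ x) × (x ≤ n))) T
  × All (Linked _≤_) T
  × (∀ r c → c < length (nth [] T (suc r)) →
        (c < length (nth [] T r))
      × (nth 0 (nth [] T r) c < nth 0 (nth [] T (suc r)) c))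
  × (length T ≤ n)
  × (∀ r → r < n → length (nth [] T r) Eq.≡ nth 0 la r)
  where import Relation.Binary.PropositionalEquality as Eq

-- Gelfand–Tsetlin pattern of T:  T(i,j) = #{entries ≤ i in row j}

GT : Tableau → ℕ → ℕ → ℕ
GT T i j = length (filterᵇ (λ x → x ≤ᵇ i) (rowOf T j))

-- number of entries equal to v in columns ≥ c (c 1-based)
countFrom : ℕ → ℕ → Tableau → ℕ
countFrom v c T = sum (map (λ row → length (filterᵇ (λ x → x ≡ᵇ v) (drop (c ∸ 1) row))) T)

h : ℕ → Tableau → ℕ → ℤ
h i T j = + countFrom (suc i) j T - + countFrom i j T

-- ε_i(T) = max_j h_i(j), including h_i(∞) = 0; columns j run over
-- 1,…,(length of row 1), beyond which h_i(j) = 0.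
ε : ℕ → Tableau → ℤ
ε i T = foldr _⊔_ 0ℤ (map (h i T) (applyUpTo suc (length (rowOf T 1))))

Dominant : ℕ → List ℕ → Tableau → Set
Dominant n mu T = ∀ i → 1 ≤ i → i ≤ n ∸ 1 → ε i T Data.Integer.≤ (+ (part mu i ∸ part mu (suc i)))
  where import Data.Integer

bRows : ℕ → List ℕ → Tableau
bRows k []       = []
bRows k (m ∷ ms) = replicate m k ∷ bRows (suc k) ms

b : List ℕ → Tableau
b mu = bRows 1 mu

rowIns : ℕ → List ℕ → Maybe ℕ × List ℕ
rowIns x []       = nothing , [ x ]
rowIns x (y ∷ ys) with x <ᵇ y
... | true  = just y , (x ∷ ys)
... | false with rowIns x ys
...   | (m , ys') = m , (y ∷ ys')

insert : Tableau → ℕ → Tableau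
insert []       x = [ [ x ] ]
insert (r ∷ rs) x with rowIns x r
... | (nothing , r') = r' ∷ rs
... | (just y  , r') = r' ∷ insert rs y

insertRow : Tableau → List ℕ → Tableau
insertRow = foldl insert

-- Jd T U n d = J^{n−d}:  J^n = T,  J^{k−1} = J^k ← (row k of U)
Jd : Tableau → Tableau → ℕ → ℕ → Tableau
Jd T U n zero    = T
Jd T U n (suc d) = insertRow (Jd T U n d) (rowOf U (n ∸ d))

J : Tableau → Tableau → ℕ → ℕ → Tableau
J T U n k = Jd T U n (n ∸ k)

tailSum : Tableau → ℕ → ℕ
tailSum S j = sum (map length (drop (j ∸ 1) S))

R : ℕ → Tableau → Tableau → ℕ → ℕ → ℤ
R n T U i j = + tailSum (J T U n (suc (i ∸ j))) j - + tailSum (J T U n (i ∸ j)) (suc j)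

-- Row r (counted from 0) of J^k has a closed form: the entries ≤ r + k of row r of T, followed by
-- #(r + k + 1 in rows 0, …, r of T) + μ_(r+k+1) copies of r + k + 1.  It holds for J^n = T, and
-- inserting the row (k + 1)^(μ_(k+1)) of b_μ into J^(k+1) makes the top letters of every row cascade
-- one row down, which gives the closed form for J^k provided the numbers of letters arriving in
-- successive rows weakly decrease.  This is where μ-dominance enters: at the first column c where row s
-- exceeds i, h_i(c) ≥ #(i + 1 in rows 0, …, s) − #(i in rows 0, …, s − 1), because columns weakly
-- increase; and h_i(c) ≤ ε_i(T) ≤ μ_i − μ_(i+1).  With the closed form the two tail sums defining
-- R(T, b_μ)(i, j) telescope to the number of entries ≤ i in row j of T.

module Submission where

open import Defs
open import Data.Nat using (ℕ; _≤_)
open import Data.List using (List)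
open import Data.Integer using (+_)
open import Relation.Binary.PropositionalEquality using (_≡_)

open import Data.Nat using (zero; suc; _+_; _∸_; _<_; _≥_; _≤ᵇ_; _≡ᵇ_; _<ᵇ_; z≤n; s≤s; z<s; s≤s⁻¹)
open import Data.Nat.Properties
open import Data.Nat.ListAction using (sum)
open import Data.Bool using (true; false)
open import Data.Bool.Properties using (T-≡)
import Data.Integer as ℤ
open import Data.Integer using (_⊖_; 0ℤ; _⊔_)
import Data.Integer.Properties as ℤ
open import Data.List using ([]; _∷_; [_]; _++_; length; map; take; drop; replicate; foldr; applyUpTo; filterᵇ)
open import Data.List.Properties
  using ( filter-accept; filter-reject; filter-all; filter-none; filter-++; length-filter; length-++
        ; length-replicate; take++drop≡id; drop-[]; drop-all; ++-assoc; ++-identityʳ; ++-conicalˡ; ++-conicalʳ)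
open import Data.List.Relation.Unary.All as All using (All; []; _∷_)
open import Data.List.Relation.Unary.All.Properties using (all-filter; ++⁺)
open import Data.List.Relation.Unary.Any using (here; there)
open import Data.List.Relation.Unary.Linked as Linked using (Linked; []; [-]; _∷_)
open import Data.List.Relation.Unary.Linked.Properties using (Linked⇒All)
open import Data.List.Relation.Binary.Prefix.Heterogeneous as Prefix using (Prefix; []; _∷_)
open import Data.List.Relation.Binary.Prefix.Heterogeneous.Properties as Prefixₚ using (length-mono; drop⁺; fromPointwise)
import Data.List.Relation.Binary.Pointwise as Pointwise
open import Data.List.Membership.Propositional using (_∈_)
open import Data.List.Membership.Propositional.Properties using (∈-map⁺; ∈-applyUpTo⁺)
open import Data.Maybe using (Maybe; just; nothing)
open import Data.Product using (_×_; _,_; proj₁; proj₂; map₁; map₂)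
open import Function using (_∘_; id; flip; Equivalence)
open import Relation.Binary using (tri<; tri≈; tri>)
open import Relation.Binary.PropositionalEquality using (refl; sym; trans; cong; cong₂; subst; _≢_; module ≡-Reasoning)
open import Relation.Nullary using (yes; no; contradiction)
open import Relation.Nullary.Decidable using (T?)

atMost : ℕ → List ℕ → List ℕ
atMost v = filterᵇ (_≤ᵇ v)

count : ℕ → List ℕ → ℕ
count v xs = length (filterᵇ (_≡ᵇ v) xs)

All-<-sorted : ∀ {w x xs} → w < x → Linked _≤_ (x ∷ xs) → All (w <_) (x ∷ xs)
All-<-sorted w<x sorted = All.map (<-≤-trans w<x) (Linked⇒All ≤-trans ≤-refl sorted)

module _ {v : ℕ} where

  atMost-accept : ∀ {x} xs → x ≤ v → atMost v (x ∷ xs) ≡ x ∷ atMost v xs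
  atMost-accept {x} xs x≤v = filter-accept (T? ∘ (_≤ᵇ v)) {x} {xs} (≤⇒≤ᵇ x≤v)

  atMost-reject : ∀ {x} xs → v < x → atMost v (x ∷ xs) ≡ atMost v xs
  atMost-reject {x} xs v<x = filter-reject (T? ∘ (_≤ᵇ v)) {x} {xs} (<⇒≱ v<x ∘ ≤ᵇ⇒≤ x v)

  atMost-all : ∀ {xs} → All (_≤ v) xs → atMost v xs ≡ xs
  atMost-all xs≤v = filter-all (T? ∘ (_≤ᵇ v)) (All.map ≤⇒≤ᵇ xs≤v)

  atMost-none : ∀ {xs} → All (v <_) xs → atMost v xs ≡ []
  atMost-none v<xs = filter-none (T? ∘ (_≤ᵇ v)) (All.map (λ v<x → <⇒≱ v<x ∘ ≤ᵇ⇒≤ _ v) v<xs)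

  atMost-≤ : ∀ xs → All (_≤ v) (atMost v xs)
  atMost-≤ xs = All.map (≤ᵇ⇒≤ _ v) (all-filter (T? ∘ (_≤ᵇ v)) xs)

  length-atMost-≤ : ∀ xs → length (atMost v xs) ≤ length xs
  length-atMost-≤ = length-filter (T? ∘ (_≤ᵇ v))

  count-accept : ∀ xs → count v (v ∷ xs) ≡ suc (count v xs)
  count-accept xs = cong length (filter-accept (T? ∘ (_≡ᵇ v)) {v} {xs} (≡⇒≡ᵇ v v refl))

  count-reject : ∀ {x} xs → x ≢ v → count v (x ∷ xs) ≡ count v xs
  count-reject {x} xs x≢v = cong length (filter-reject (T? ∘ (_≡ᵇ v)) {x} {xs} (x≢v ∘ ≡ᵇ⇒≡ x v))

  count-none : ∀ {xs} → All (_≢ v) xs → count v xs ≡ 0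
  count-none {[]}     []           = refl
  count-none {x ∷ xs} (x≢v ∷ xs≢v) = trans (count-reject xs x≢v) (count-none xs≢v)

  count-take-drop : ∀ c xs → count v xs ≡ count v (take c xs) + count v (drop c xs)
  count-take-drop c xs = begin
    count v xs                                  ≡⟨ cong (count v) (sym (take++drop≡id c xs)) ⟩
    count v (take c xs ++ drop c xs)            ≡⟨ cong length (filter-++ (T? ∘ (_≡ᵇ v)) (take c xs) (drop c xs)) ⟩
    length (filterᵇ (_≡ᵇ v) (take c xs) ++ filterᵇ (_≡ᵇ v) (drop c xs))
                                                ≡⟨ length-++ (filterᵇ (_≡ᵇ v) (take c xs)) ⟩
    count v (take c xs) + count v (drop c xs)   ∎
    where open ≡-Reasoning

  count-drop-≤ : ∀ c xs → count v (drop c xs) ≤ count v xs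
  count-drop-≤ c xs = ≤-trans (m≤n+m _ _) (≤-reflexive (sym (count-take-drop c xs)))

  atMost-split : ∀ {xs} → Linked _≤_ xs →
                 All (_≤ v) (take (length (atMost v xs)) xs) × All (v <_) (drop (length (atMost v xs)) xs)
  atMost-split {[]}     _      = [] , []
  atMost-split {x ∷ xs} sorted with x ≤? v
  ... | yes x≤v rewrite atMost-accept xs x≤v =
    let below , above = atMost-split (Linked.tail sorted) in x≤v ∷ below , above
  ... | no x≰v rewrite atMost-none (All-<-sorted (≰⇒> x≰v) sorted) = [] , All-<-sorted (≰⇒> x≰v) sorted

atMost-suc : ∀ {v xs} → Linked _≤_ xs →
             atMost (suc v) xs ≡ atMost v xs ++ replicate (count (suc v) xs) (suc v)
atMost-suc {v} {[]}     _      = refl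
atMost-suc {v} {x ∷ xs} sorted with <-cmp x (suc v)
... | tri< x<1+v _ _
  rewrite atMost-accept {suc v} xs (<⇒≤ x<1+v) | atMost-accept {v} xs (≤-pred x<1+v)
        | count-reject {suc v} xs (<⇒≢ x<1+v)
  = cong (x ∷_) (atMost-suc (Linked.tail sorted))
... | tri≈ _ refl _
  rewrite atMost-accept {suc v} xs ≤-refl | atMost-reject {v} xs ≤-refl | count-accept {suc v} xs
        | atMost-none {v} (All.tail (All-<-sorted ≤-refl sorted))
  = cong (suc v ∷_) (trans (atMost-suc (Linked.tail sorted))
                           (cong (_++ replicate (count (suc v) xs) (suc v))
                                 (atMost-none (All.tail (All-<-sorted ≤-refl sorted)))))
... | tri> _ _ 1+v<x
  rewrite atMost-reject {suc v} xs 1+v<x | atMost-reject {v} xs (<-trans ≤-refl 1+v<x)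
        | count-reject {suc v} xs (>⇒≢ 1+v<x)
  = atMost-suc (Linked.tail sorted)

replicate-+ : ∀ {A : Set} a b (x : A) → replicate (a + b) x ≡ replicate a x ++ replicate b x
replicate-+ zero    b x = refl
replicate-+ (suc a) b x = cong (x ∷_) (replicate-+ a b x)

length-++-replicate : ∀ {A : Set} (xs : List A) a x → length (xs ++ replicate a x) ≡ length xs + a
length-++-replicate xs a x = trans (length-++ xs) (cong (_+_ (length xs)) (length-replicate a))

All-nth : ∀ {A : Set} {P : A → Set} d → P d → ∀ {xs} → All P xs → ∀ r → P (nth d xs r)
All-nth d Pd []         r       = Pd
All-nth d Pd (Px ∷ Pxs) zero    = Px
All-nth d Pd (Px ∷ Pxs) (suc r) = All-nth d Pd Pxs r

nth-beyond : ∀ {A : Set} (d : A) xs r → length xs ≤ r → nth d xs r ≡ d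
nth-beyond d []       r       _           = refl
nth-beyond d (x ∷ xs) (suc r) (s≤s xs≤r) = nth-beyond d xs r xs≤r

Linked-≥-nth : ∀ {xs} → Linked _≥_ xs → ∀ r → nth 0 xs (suc r) ≤ nth 0 xs r
Linked-≥-nth []                r       = z≤n
Linked-≥-nth [-]               r       = z≤n
Linked-≥-nth (x≥y ∷ _)         zero    = x≥y
Linked-≥-nth (_ ∷ y∷ys-sorted) (suc r) = Linked-≥-nth y∷ys-sorted r

Prefix-from-nth : ∀ {R : ℕ → ℕ → Set} {ys xs} →
  (∀ c → c < length ys → c < length xs × R (nth 0 ys c) (nth 0 xs c)) → Prefix R ys xs
Prefix-from-nth {ys = []}              _    = []
Prefix-from-nth {ys = y ∷ ys} {[]}     R-at = contradiction (proj₁ (R-at 0 z<s)) λ ()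
Prefix-from-nth {ys = y ∷ ys} {x ∷ xs} R-at =
  proj₂ (R-at 0 z<s) ∷ Prefix-from-nth (λ c c<ys → map₁ s≤s⁻¹ (R-at (suc c) (s≤s c<ys)))

Prefix-≥-take : ∀ {I c ys xs} → Prefix _≥_ ys xs → c ≤ length ys →
                All (_≤ I) (take c ys) → All (_≤ I) (take c xs)
Prefix-≥-take {c = zero}  _              _          _            = []
Prefix-≥-take {c = suc c} (y≥x ∷ ys≥xs) (s≤s c≤ys) (y≤I ∷ ys≤I) =
  ≤-trans y≥x y≤I ∷ Prefix-≥-take ys≥xs c≤ys ys≤I

Prefix-≥-All< : ∀ {I ys xs} → Prefix _≥_ ys xs → All (I <_) xs → All (I <_) ys
Prefix-≥-All< []             _            = []
Prefix-≥-All< (y≥x ∷ ys≥xs) (I<x ∷ I<xs) = <-≤-trans I<x y≥x ∷ Prefix-≥-All< ys≥xs I<xs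

sumFrom : (ℕ → ℕ) → ℕ → ℕ → ℕ
sumFrom f j zero    = 0
sumFrom f j (suc t) = f j + sumFrom f (suc j) t

sumFrom-cong : ∀ {f g} → (∀ r → f r ≡ g r) → ∀ j t → sumFrom f j t ≡ sumFrom g j t
sumFrom-cong f≗g j zero    = refl
sumFrom-cong f≗g j (suc t) = cong₂ _+_ (f≗g j) (sumFrom-cong f≗g (suc j) t)

sumFrom-mono-≤ : ∀ {f g} j t → (∀ r → r < j + t → f r ≤ g r) → sumFrom f j t ≤ sumFrom g j t
sumFrom-mono-≤ j zero    f≤g = z≤n
sumFrom-mono-≤ j (suc t) f≤g =
  +-mono-≤ (f≤g j (m<m+n j z<s))
           (sumFrom-mono-≤ (suc j) t (λ r r<1+j+t → f≤g r (subst (r <_) (sym (+-suc j t)) r<1+j+t)))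

sumFrom-zero : ∀ {f} j t → (∀ r → j ≤ r → f r ≡ 0) → sumFrom f j t ≡ 0
sumFrom-zero j zero    f≡0 = refl
sumFrom-zero j (suc t) f≡0 = cong₂ _+_ (f≡0 j ≤-refl) (sumFrom-zero (suc j) t (λ r j<r → f≡0 r (<⇒≤ j<r)))

module _ (f : ℕ → ℕ) where

  sumFrom-shift : ∀ j t → sumFrom f (suc j) t ≡ sumFrom (f ∘ suc) j t
  sumFrom-shift j zero    = refl
  sumFrom-shift j (suc t) = cong (_+_ (f (suc j))) (sumFrom-shift (suc j) t)

  sumFrom-snoc : ∀ j t → sumFrom f j (suc t) ≡ sumFrom f j t + f (j + t)
  sumFrom-snoc j zero    = trans (+-comm (f j) 0) (cong f (sym (+-identityʳ j)))
  sumFrom-snoc j (suc t) = begin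
    f j + sumFrom f (suc j) (suc t)             ≡⟨ cong (_+_ (f j)) (sumFrom-snoc (suc j) t) ⟩
    f j + (sumFrom f (suc j) t + f (suc j + t)) ≡⟨ +-assoc (f j) _ _ ⟨
    sumFrom f j (suc t) + f (suc j + t)         ≡⟨ cong (λ r → sumFrom f j (suc t) + f r) (+-suc j t) ⟨
    sumFrom f j (suc t) + f (j + suc t)         ∎
    where open ≡-Reasoning

  sumFrom-+ : ∀ j t u → sumFrom f j (t + u) ≡ sumFrom f j t + sumFrom f (j + t) u
  sumFrom-+ j zero    u = cong (λ i → sumFrom f i u) (sym (+-identityʳ j))
  sumFrom-+ j (suc t) u = begin
    f j + sumFrom f (suc j) (t + u)
      ≡⟨ cong (_+_ (f j)) (sumFrom-+ (suc j) t u) ⟩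
    f j + (sumFrom f (suc j) t + sumFrom f (suc j + t) u)
      ≡⟨ +-assoc (f j) _ _ ⟨
    sumFrom f j (suc t) + sumFrom f (suc j + t) u
      ≡⟨ cong (λ i → sumFrom f j (suc t) + sumFrom f i u) (+-suc j t) ⟨
    sumFrom f j (suc t) + sumFrom f (j + suc t) u
      ∎
    where open ≡-Reasoning

sumFrom-telescope : ∀ {f g a : ℕ → ℕ} → (∀ r → f r + a (suc r) ≡ a r + g (suc r)) →
                    ∀ j t → a (j + t) ≡ 0 → sumFrom f j t ≡ a j + sumFrom g (suc j) t
sumFrom-telescope {a = a} step j zero a≡0 =
  sym (trans (+-identityʳ (a j)) (trans (cong a (sym (+-identityʳ j))) a≡0))
sumFrom-telescope {f} {g} {a} step j (suc t) a≡0 = begin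
  f j + sumFrom f (suc j) t                       ≡⟨ cong (_+_ (f j)) (sumFrom-telescope step (suc j) t a[1+j+t]≡0) ⟩
  f j + (a (suc j) + sumFrom g (suc (suc j)) t)   ≡⟨ +-assoc (f j) _ _ ⟨
  f j + a (suc j) + sumFrom g (suc (suc j)) t     ≡⟨ cong (_+ sumFrom g (suc (suc j)) t) (step j) ⟩
  a j + g (suc j) + sumFrom g (suc (suc j)) t     ≡⟨ +-assoc (a j) _ _ ⟩
  a j + sumFrom g (suc j) (suc t)                 ∎
  where
  open ≡-Reasoning
  a[1+j+t]≡0 : a (suc j + t) ≡ 0
  a[1+j+t]≡0 = trans (cong a (sym (+-suc j t))) a≡0

sum-map-drop : ∀ {A : Set} (φ : List A → ℕ) S j t → (∀ r → j + t ≤ r → φ (nth [] S r) ≡ 0) →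
               sum (map φ (drop j S)) ≡ sumFrom (φ ∘ nth [] S) j t
sum-map-drop φ []      j       t       φ≡0 =
  trans (cong (sum ∘ map φ) (drop-[] j)) (sym (sumFrom-zero j t (λ _ _ → φ≡0 (j + t) ≤-refl)))
sum-map-drop φ (x ∷ S) (suc j) t       φ≡0 =
  trans (sum-map-drop φ S j t (λ r j+t≤r → φ≡0 (suc r) (s≤s j+t≤r)))
        (sym (sumFrom-shift (φ ∘ nth [] (x ∷ S)) j t))
sum-map-drop φ (x ∷ S) zero    zero    φ≡0 =
  cong₂ _+_ (φ≡0 0 z≤n) (sum-map-drop φ S 0 0 (λ r _ → φ≡0 (suc r) z≤n))
sum-map-drop φ (x ∷ S) zero    (suc t) φ≡0 =
  cong (_+_ (φ x)) (trans (sum-map-drop φ S 0 t (λ r t≤r → φ≡0 (suc r) (s≤s t≤r)))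
                          (sym (sumFrom-shift (φ ∘ nth [] (x ∷ S)) 0 t)))

foldr-⊔-upper : ∀ w {x xs} → x ∈ xs → x ℤ.≤ foldr _⊔_ w xs
foldr-⊔-upper w (here refl)  = ℤ.i≤i⊔j _ _
foldr-⊔-upper w (there x∈xs) = ℤ.i≤j⇒i≤k⊔j _ (foldr-⊔-upper w x∈xs)

foldr-⊔-lower : ∀ w xs → w ℤ.≤ foldr _⊔_ w xs
foldr-⊔-lower w []       = ℤ.≤-refl
foldr-⊔-lower w (x ∷ xs) = ℤ.i≤j⇒i≤k⊔j x (foldr-⊔-lower w xs)

m⊖n≤+o⇒m≤n+o : ∀ {m n o} → m ⊖ n ℤ.≤ + o → m ≤ n + o
m⊖n≤+o⇒m≤n+o {m} {n} {o} m⊖n≤o with n ≤? m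
... | yes n≤m = begin
  m             ≡⟨ m∸n+n≡m n≤m ⟨
  m ∸ n + n     ≤⟨ +-monoˡ-≤ n (ℤ.drop‿+≤+ (subst (ℤ._≤ + o) (ℤ.⊖-≥ n≤m) m⊖n≤o)) ⟩
  o + n         ≡⟨ +-comm o n ⟩
  n + o         ∎
  where open ≤-Reasoning
... | no n≰m = ≤-trans (<⇒≤ (≰⇒> n≰m)) (m≤m+n n o)

+[m+n]-+n≡+m : ∀ m n → + (m + n) ℤ.- + n ≡ + m
+[m+n]-+n≡+m m n =
  trans (ℤ.m-n≡m⊖n (m + n) n) (trans (ℤ.⊖-≥ (m≤n+m n m)) (cong +_ (m+n∸n≡m m n)))

<ᵇ-true : ∀ {x y} → x < y → (x <ᵇ y) ≡ true
<ᵇ-true x<y = Equivalence.to T-≡ (<⇒<ᵇ x<y)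

<ᵇ-false : ∀ {x y} → y ≤ x → (x <ᵇ y) ≡ false
<ᵇ-false {x} {y} y≤x with x <ᵇ y in x<ᵇy
... | false = refl
... | true  = contradiction (<ᵇ⇒< x y (Equivalence.from T-≡ x<ᵇy)) (≤⇒≯ y≤x)

rowIns-++ : ∀ x C ys → All (_≤ x) C → rowIns x (C ++ ys) ≡ map₂ (C ++_) (rowIns x ys)
rowIns-++ x []      ys []          = refl
rowIns-++ x (y ∷ C) ys (y≤x ∷ C≤x) rewrite <ᵇ-false y≤x | rowIns-++ x C ys C≤x = refl

rowIns-append : ∀ x C → All (_≤ x) C → rowIns x C ≡ (nothing , C ++ [ x ])
rowIns-append x C C≤x =
  subst (λ C′ → rowIns x C′ ≡ (nothing , C ++ [ x ])) (++-identityʳ C) (rowIns-++ x C [] C≤x)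

rowIns-bump : ∀ x ys → rowIns x (suc x ∷ ys) ≡ (just (suc x) , x ∷ ys)
rowIns-bump x ys rewrite <ᵇ-true (n<1+n x) = refl

prependBumped : Maybe ℕ → List ℕ × List ℕ → List ℕ × List ℕ
prependBumped nothing  = id
prependBumped (just y) = map₁ (y ∷_)

rowInsWord : List ℕ → List ℕ → List ℕ × List ℕ
rowInsWord row []      = [] , row
rowInsWord row (x ∷ w) = prependBumped (proj₁ (rowIns x row)) (rowInsWord (proj₂ (rowIns x row)) w)

rowInsWord-∷ : ∀ x row w {m row′} → rowIns x row ≡ (m , row′) →
               rowInsWord row (x ∷ w) ≡ prependBumped m (rowInsWord row′ w)
rowInsWord-∷ x row w eq = cong (λ p → prependBumped (proj₁ p) (rowInsWord (proj₂ p) w)) eq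

insertRow-∷ : ∀ row rs w →
              insertRow (row ∷ rs) w ≡ proj₂ (rowInsWord row w) ∷ insertRow rs (proj₁ (rowInsWord row w))
insertRow-∷ row rs []      = refl
insertRow-∷ row rs (x ∷ w) with rowIns x row
... | nothing , row′ = insertRow-∷ row′ rs w
... | just y  , row′ = insertRow-∷ row′ (insert rs y) w

rowInsWord-append : ∀ k C a → All (_≤ k) C → rowInsWord C (replicate a k) ≡ ([] , C ++ replicate a k)
rowInsWord-append k C zero    _   = cong ([] ,_) (sym (++-identityʳ C))
rowInsWord-append k C (suc a) C≤k = begin
  rowInsWord C (k ∷ replicate a k)          ≡⟨ rowInsWord-∷ k C (replicate a k) (rowIns-append k C C≤k) ⟩
  rowInsWord (C ++ [ k ]) (replicate a k)   ≡⟨ rowInsWord-append k (C ++ [ k ]) a (++⁺ C≤k (≤-refl ∷ [])) ⟩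
  [] , (C ++ [ k ]) ++ replicate a k        ≡⟨ cong ([] ,_) (++-assoc C [ k ] (replicate a k)) ⟩
  [] , C ++ replicate (suc a) k             ∎
  where open ≡-Reasoning

rowInsWord-replicate : ∀ k C {a b} → All (_≤ k) C → b ≤ a →
  rowInsWord (C ++ replicate b (suc k)) (replicate a k) ≡ (replicate b (suc k) , C ++ replicate a k)
rowInsWord-replicate k C {a} C≤k z≤n =
  trans (cong (λ row → rowInsWord row (replicate a k)) (++-identityʳ C)) (rowInsWord-append k C a C≤k)
rowInsWord-replicate k C {suc a} {suc b} C≤k (s≤s b≤a) = begin
    rowInsWord (C ++ suc k ∷ replicate b (suc k)) (k ∷ replicate a k)
  ≡⟨ rowInsWord-∷ k (C ++ suc k ∷ replicate b (suc k)) (replicate a k) bump ⟩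
    map₁ (suc k ∷_) (rowInsWord (C ++ k ∷ replicate b (suc k)) (replicate a k))
  ≡⟨ cong (λ row → map₁ (suc k ∷_) (rowInsWord row (replicate a k))) (++-assoc C [ k ] _) ⟨
    map₁ (suc k ∷_) (rowInsWord ((C ++ [ k ]) ++ replicate b (suc k)) (replicate a k))
  ≡⟨ cong (map₁ (suc k ∷_)) (rowInsWord-replicate k (C ++ [ k ]) (++⁺ C≤k (≤-refl ∷ [])) b≤a) ⟩
    replicate (suc b) (suc k) , (C ++ [ k ]) ++ replicate a k
  ≡⟨ cong (replicate (suc b) (suc k) ,_) (++-assoc C [ k ] (replicate a k)) ⟩
    replicate (suc b) (suc k) , C ++ replicate (suc a) k
  ∎
  where
  open ≡-Reasoning
  bump : rowIns k (C ++ suc k ∷ replicate b (suc k)) ≡ (just (suc k) , C ++ k ∷ replicate b (suc k))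
  bump = trans (rowIns-++ k C (suc k ∷ replicate b (suc k)) C≤k)
               (cong (map₂ (C ++_)) (rowIns-bump k (replicate b (suc k))))

nth-insertRow-[]-replicate : ∀ k a r → nth [] (insertRow [] (replicate a k)) r ≡ nth [] [ replicate a k ] r
nth-insertRow-[]-replicate k zero    zero    = refl
nth-insertRow-[]-replicate k zero    (suc r) = refl
nth-insertRow-[]-replicate k (suc a) r       = cong (λ S → nth [] S r) (begin
  insertRow [ [ k ] ] (replicate a k)
    ≡⟨ insertRow-∷ [ k ] [] (replicate a k) ⟩
  proj₂ W ∷ insertRow [] (proj₁ W)
    ≡⟨ cong (λ p → proj₂ p ∷ insertRow [] (proj₁ p)) (rowInsWord-append k [ k ] a (≤-refl ∷ [])) ⟩
  [ replicate (suc a) k ]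
    ∎)
  where
  open ≡-Reasoning
  W = rowInsWord [ k ] (replicate a k)

-- The k's displace the k + 1's of row 0, which displace the k + 2's of row 1, and so on.
insertRow-replicate : ∀ S k (D : ℕ → List ℕ) (m : ℕ → ℕ) →
  (∀ r → All (_≤ r + k) (D r)) → (∀ r → m (suc r) ≤ m r) →
  (∀ r → nth [] S r ≡ D r ++ replicate (m (suc r)) (suc r + k)) →
  ∀ r → nth [] (insertRow S (replicate (m 0) k)) r ≡ D r ++ replicate (m r) (r + k)
insertRow-replicate [] k D m _ _ rows r = trans (nth-insertRow-[]-replicate k (m 0) r) (onlyRow r)
  where
  D≡[] : ∀ r → D r ≡ []
  D≡[] r = ++-conicalˡ (D r) _ (sym (rows r))
  m[1+r]≡0 : ∀ r → m (suc r) ≡ 0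
  m[1+r]≡0 r = trans (sym (length-replicate (m (suc r)))) (cong length (++-conicalʳ (D r) _ (sym (rows r))))
  onlyRow : ∀ r → nth [] [ replicate (m 0) k ] r ≡ D r ++ replicate (m r) (r + k)
  onlyRow zero    = cong (_++ replicate (m 0) k) (sym (D≡[] 0))
  onlyRow (suc r) = sym (cong₂ _++_ (D≡[] (suc r)) (cong (λ a → replicate a (suc r + k)) (m[1+r]≡0 r)))
insertRow-replicate (row ∷ rs) k D m D≤ m↓ rows = λ where
    zero    → cong (λ S → nth [] S 0) inserted
    (suc r) → begin
      nth [] (insertRow (row ∷ rs) (replicate (m 0) k)) (suc r)
        ≡⟨ cong (λ S → nth [] S (suc r)) inserted ⟩
      nth [] (insertRow rs (replicate (m 1) (suc k))) r
        ≡⟨ insertRow-replicate rs (suc k) (D ∘ suc) (m ∘ suc) D≤′ (m↓ ∘ suc) rows′ r ⟩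
      D (suc r) ++ replicate (m (suc r)) (r + suc k)
        ≡⟨ cong (λ ℓ → D (suc r) ++ replicate (m (suc r)) ℓ) (+-suc r k) ⟩
      D (suc r) ++ replicate (m (suc r)) (suc r + k)
        ∎
  where
  open ≡-Reasoning
  W≡ : rowInsWord row (replicate (m 0) k) ≡ (replicate (m 1) (suc k) , D 0 ++ replicate (m 0) k)
  W≡ = trans (cong (λ row → rowInsWord row (replicate (m 0) k)) (rows 0))
             (rowInsWord-replicate k (D 0) (D≤ 0) (m↓ 0))
  inserted : insertRow (row ∷ rs) (replicate (m 0) k)
           ≡ (D 0 ++ replicate (m 0) k) ∷ insertRow rs (replicate (m 1) (suc k))
  inserted = trans (insertRow-∷ row rs (replicate (m 0) k)) (cong (λ p → proj₂ p ∷ insertRow rs (proj₁ p)) W≡)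
  D≤′ : ∀ r → All (_≤ r + suc k) (D (suc r))
  D≤′ r = subst (λ ℓ → All (_≤ ℓ) (D (suc r))) (sym (+-suc r k)) (D≤ (suc r))
  rows′ : ∀ r → nth [] rs r ≡ D (suc r) ++ replicate (m (suc (suc r))) (suc r + suc k)
  rows′ r = trans (rows (suc r))
                  (cong (λ ℓ → D (suc r) ++ replicate (m (suc (suc r))) (suc ℓ)) (sym (+-suc r k)))

b-row : ∀ s mu k → nth [] (bRows s mu) k ≡ replicate (nth 0 mu k) (s + k)
b-row s []       k       = refl
b-row s (m ∷ ms) zero    = cong (replicate m) (sym (+-identityʳ s))
b-row s (m ∷ ms) (suc k) = trans (b-row (suc s) ms k) (cong (replicate (nth 0 ms k)) (sym (+-suc s k)))

-- Rows are counted from 0 (row r is rowOf T (suc r)); Prefix _≥_ encodes weakly increasing columns.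
module TableauRows (n : ℕ) (T : Tableau)
  (entries≤n : ∀ r → All (_≤ n) (nth [] T r))
  (rows-sorted : ∀ r → Linked _≤_ (nth [] T r))
  (columns : ∀ r → Prefix _≥_ (nth [] T (suc r)) (nth [] T r))
  (length≤n : length T ≤ n) where

  row : ℕ → List ℕ
  row = nth [] T

  row-empty : ∀ {r} → n ≤ r → row r ≡ []
  row-empty n≤r = nth-beyond [] T _ (≤-trans length≤n n≤r)

  rows-prefix-+ : ∀ d r → Prefix _≥_ (row (d + r)) (row r)
  rows-prefix-+ zero    r = fromPointwise (Pointwise.refl ≤-refl)
  rows-prefix-+ (suc d) r = Prefixₚ.trans (flip ≤-trans) (columns (d + r)) (rows-prefix-+ d r)

  rows-prefix : ∀ {r s} → r ≤ s → Prefix _≥_ (row s) (row r)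
  rows-prefix {r} {s} r≤s =
    subst (λ s → Prefix _≥_ (row s) (row r)) (m∸n+n≡m r≤s) (rows-prefix-+ (s ∸ r) r)

  countAbove : ℕ → ℕ → ℕ
  countAbove v s = sumFrom (count v ∘ row) 0 s

  countAbove-big : ∀ {v} s → n < v → countAbove v s ≡ 0
  countAbove-big s n<v =
    sumFrom-zero 0 s (λ r _ → count-none (All.map (λ x≤n → <⇒≢ (≤-<-trans x≤n n<v)) (entries≤n r)))

  countFrom-sumFrom : ∀ v c t → n ≤ t →
                      countFrom v (suc c) T ≡ sumFrom (λ r → count v (drop c (row r))) 0 t
  countFrom-sumFrom v c t n≤t =
    sum-map-drop (count v ∘ drop c) T 0 t λ r t≤r →
      trans (cong (count v ∘ drop c) (row-empty (≤-trans n≤t t≤r))) (cong (count v) (drop-[] c))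

  -- Row s exceeds I exactly from column cut I s on.  As columns weakly increase, no I + 1 lies left
  -- of that column in rows 0, …, s, and no I lies in it or right of it in rows s, s + 1, …
  cut : ℕ → ℕ → ℕ
  cut I s = length (atMost I (row s))

  countAbove-≤-countFrom : ∀ I s → countAbove (suc I) (suc s) ≤ countFrom (suc I) (suc (cut I s)) T
  countAbove-≤-countFrom I s = begin
    countAbove (suc I) (suc s)                ≤⟨ sumFrom-mono-≤ 0 (suc s) (λ r → ≤-reflexive ∘ count≡ r ∘ s≤s⁻¹) ⟩
    sumFrom g 0 (suc s)                       ≤⟨ m≤m+n _ _ ⟩
    sumFrom g 0 (suc s) + sumFrom g (suc s) n ≡⟨ sumFrom-+ g 0 (suc s) n ⟨
    sumFrom g 0 (suc s + n)                   ≡⟨ countFrom-sumFrom (suc I) c (suc s + n) (m≤n+m n (suc s)) ⟨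
    countFrom (suc I) (suc c) T               ∎
    where
    open ≤-Reasoning
    c = cut I s
    g = λ r → count (suc I) (drop c (row r))
    count≡ : ∀ r → r ≤ s → count (suc I) (row r) ≡ g r
    count≡ r r≤s = begin-equality
      count (suc I) (row r)                 ≡⟨ count-take-drop c (row r) ⟩
      count (suc I) (take c (row r)) + g r  ≡⟨ cong (_+ g r) (count-none (All.map (<⇒≢ ∘ s≤s) left)) ⟩
      g r                                   ∎
      where
      left : All (_≤ I) (take c (row r))
      left = Prefix-≥-take (rows-prefix r≤s) (length-atMost-≤ (row s)) (proj₁ (atMost-split (rows-sorted s)))

  countFrom-≤-countAbove : ∀ I s → countFrom I (suc (cut I s)) T ≤ countAbove I s
  countFrom-≤-countAbove I s = begin
    countFrom I (suc c) T          ≡⟨ countFrom-sumFrom I c (s + n) (m≤n+m n s) ⟩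
    sumFrom g 0 (s + n)            ≡⟨ sumFrom-+ g 0 s n ⟩
    sumFrom g 0 s + sumFrom g s n  ≡⟨ cong (_+_ (sumFrom g 0 s)) (sumFrom-zero s n g≡0) ⟩
    sumFrom g 0 s + 0              ≡⟨ +-identityʳ _ ⟩
    sumFrom g 0 s                  ≤⟨ sumFrom-mono-≤ 0 s (λ r _ → count-drop-≤ {I} c (row r)) ⟩
    countAbove I s                 ∎
    where
    open ≤-Reasoning
    c = cut I s
    g = λ r → count I (drop c (row r))
    g≡0 : ∀ r → s ≤ r → g r ≡ 0
    g≡0 r s≤r = count-none (All.map >⇒≢ (Prefix-≥-All< (drop⁺ c (rows-prefix s≤r))
                                                       (proj₂ (atMost-split (rows-sorted s)))))

  h-≤-ε : ∀ I c → h I T (suc c) ℤ.≤ ε I T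
  h-≤-ε I c with c <? length (row 0)
  ... | yes c<len = foldr-⊔-upper 0ℤ (∈-map⁺ (h I T) (∈-applyUpTo⁺ suc c<len))
  ... | no c≮len =
    subst (ℤ._≤ ε I T) (sym h≡0) (foldr-⊔-lower 0ℤ (map (h I T) (applyUpTo suc (length (row 0)))))
    where
    countFrom≡0 : ∀ v → countFrom v (suc c) T ≡ 0
    countFrom≡0 v = trans (countFrom-sumFrom v c n ≤-refl) (sumFrom-zero 0 n λ r _ →
      cong (count v) (drop-all c (row r) (≤-trans (length-mono (rows-prefix z≤n)) (≮⇒≥ c≮len))))
    h≡0 : h I T (suc c) ≡ 0ℤ
    h≡0 = cong₂ (λ a b → + a ℤ.- + b) (countFrom≡0 (suc I)) (countFrom≡0 I)

  module Recording (mu : List ℕ) (length-mu : length mu ≡ n) (mu-sorted : Linked _≥_ mu)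
                   (dominant : Dominant n mu T) where

    -- μ r is the part μ_(r+1).
    μ : ℕ → ℕ
    μ = nth 0 mu

    μ-big : ∀ {r} → n ≤ r → μ r ≡ 0
    μ-big n≤r = nth-beyond 0 mu _ (subst (_≤ _) (sym length-mu) n≤r)

    dominance : ∀ i s → countAbove (suc (suc i)) (suc s) + μ (suc i) ≤ countAbove (suc i) s + μ i
    dominance i s with suc (suc i) ≤? n
    ... | no 2+i≰n = ≤-trans (≤-reflexive (cong₂ _+_ (countAbove-big (suc s) (≰⇒> 2+i≰n))
                                                      (μ-big (s≤s⁻¹ (≰⇒> 2+i≰n))))) z≤n
    ... | yes 2+i≤n = begin
      countAbove (suc (suc i)) (suc s) + μ (suc i) ≤⟨ +-monoˡ-≤ (μ (suc i)) (countAbove-≤-countFrom (suc i) s) ⟩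
      F⁺ + μ (suc i)                               ≤⟨ +-monoˡ-≤ (μ (suc i)) F⁺≤F+μ-gap ⟩
      F + (μ i ∸ μ (suc i)) + μ (suc i)            ≡⟨ +-assoc F _ _ ⟩
      F + (μ i ∸ μ (suc i) + μ (suc i))            ≡⟨ cong (_+_ F) (m∸n+n≡m (Linked-≥-nth mu-sorted i)) ⟩
      F + μ i                                      ≤⟨ +-monoˡ-≤ (μ i) (countFrom-≤-countAbove (suc i) s) ⟩
      countAbove (suc i) s + μ i                   ∎
      where
      open ≤-Reasoning
      c = cut (suc i) s
      F⁺ = countFrom (suc (suc i)) (suc c) T
      F = countFrom (suc i) (suc c) T
      F⁺≤F+μ-gap : F⁺ ≤ F + (μ i ∸ μ (suc i))
      F⁺≤F+μ-gap = m⊖n≤+o⇒m≤n+o (subst (ℤ._≤ + (μ i ∸ μ (suc i))) (ℤ.m-n≡m⊖n F⁺ F)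
                     (ℤ.≤-trans (h-≤-ε (suc i) c) (dominant (suc i) (s≤s z≤n) (∸-monoˡ-≤ 1 2+i≤n))))

    topCount : ℕ → ℕ → ℕ
    topCount k r = countAbove (suc (r + k)) (suc r) + μ (r + k)

    Jrow : ℕ → ℕ → List ℕ
    Jrow k r = atMost (r + k) (row r) ++ replicate (topCount k r) (suc (r + k))

    -- The letters r + k + 1 arriving in row r when row k + 1 of b μ is inserted into J^(k+1):
    -- the inserted word itself for r = 0, the letters bumped out of row r − 1 otherwise.
    carried : ℕ → ℕ → ℕ
    carried k zero    = μ k
    carried k (suc r) = topCount (suc k) r

    carried-decreasing : ∀ k r → carried k (suc r) ≤ carried k r
    carried-decreasing k zero    = dominance k 0
    carried-decreasing k (suc r) = dominance (r + suc k) (suc r)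

    topCount-carried : ∀ k r → topCount k r ≡ count (suc (r + k)) (row r) + carried k r
    topCount-carried k zero    = cong (_+ μ k) (+-identityʳ (count (suc k) (row 0)))
    topCount-carried k (suc r) rewrite +-suc r k = begin
      countAbove v (suc (suc r)) + μ (suc r + k)
        ≡⟨ cong (_+ μ (suc r + k)) (sumFrom-snoc (count v ∘ row) 0 (suc r)) ⟩
      countAbove v (suc r) + count v (row (suc r)) + μ (suc r + k)
        ≡⟨ cong (_+ μ (suc r + k)) (+-comm (countAbove v (suc r)) _) ⟩
      count v (row (suc r)) + countAbove v (suc r) + μ (suc r + k)
        ≡⟨ +-assoc (count v (row (suc r))) _ _ ⟩
      count v (row (suc r)) + (countAbove v (suc r) + μ (suc r + k))
        ∎
      where
      open ≡-Reasoning
      v = suc (suc r + k)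

    Jrow-carried : ∀ k r → Jrow k r ≡ atMost (r + suc k) (row r) ++ replicate (carried k r) (r + suc k)
    Jrow-carried k r rewrite +-suc r k = begin
      atMost (r + k) (row r) ++ replicate (topCount k r) v
        ≡⟨ cong (λ a → atMost (r + k) (row r) ++ replicate a v) (topCount-carried k r) ⟩
      atMost (r + k) (row r) ++ replicate (count v (row r) + carried k r) v
        ≡⟨ cong (atMost (r + k) (row r) ++_) (replicate-+ (count v (row r)) (carried k r) v) ⟩
      atMost (r + k) (row r) ++ (replicate (count v (row r)) v ++ replicate (carried k r) v)
        ≡⟨ ++-assoc (atMost (r + k) (row r)) _ _ ⟨
      (atMost (r + k) (row r) ++ replicate (count v (row r)) v) ++ replicate (carried k r) v
        ≡⟨ cong (_++ replicate (carried k r) v) (atMost-suc (rows-sorted r)) ⟨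
      atMost v (row r) ++ replicate (carried k r) v
        ∎
      where
      open ≡-Reasoning
      v = suc (r + k)

    Jrow-insert : ∀ k S → (∀ r → nth [] S r ≡ Jrow (suc k) r) →
                  ∀ r → nth [] (insertRow S (replicate (μ k) (suc k))) r ≡ Jrow k r
    Jrow-insert k S rows r =
      trans (insertRow-replicate S (suc k) (λ r → atMost (r + suc k) (row r)) (carried k)
                                 (λ r → atMost-≤ (row r)) (carried-decreasing k) rows r)
            (sym (Jrow-carried k r))

    topCount-big : ∀ k r → n ≤ r + k → topCount k r ≡ 0
    topCount-big k r n≤r+k = cong₂ _+_ (countAbove-big (suc r) (s≤s n≤r+k)) (μ-big n≤r+k)

    Jrow-base : ∀ r → row r ≡ Jrow n r
    Jrow-base r = sym (begin
      atMost (r + n) (row r) ++ replicate (topCount n r) (suc (r + n))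
        ≡⟨ cong₂ (λ xs a → xs ++ replicate a (suc (r + n)))
                 (atMost-all (All.map (λ x≤n → ≤-trans x≤n (m≤n+m n r)) (entries≤n r)))
                 (topCount-big n r (m≤n+m n r)) ⟩
      row r ++ []
        ≡⟨ ++-identityʳ (row r) ⟩
      row r
        ∎)
      where open ≡-Reasoning

    Jrow-empty : ∀ k {r} → n ≤ r → Jrow k r ≡ []
    Jrow-empty k {r} n≤r rewrite row-empty n≤r | topCount-big k r (≤-trans n≤r (m≤m+n r k)) = refl

    Jd-rows : ∀ d → d ≤ n → ∀ r → nth [] (Jd T (b mu) n d) r ≡ Jrow (n ∸ d) r
    Jd-rows zero    _     r = Jrow-base r
    Jd-rows (suc d) 1+d≤n r = begin
      nth [] (insertRow (Jd T (b mu) n d) (rowOf (b mu) (n ∸ d))) r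
        ≡⟨ cong (λ w → nth [] (insertRow (Jd T (b mu) n d) w) r)
                (trans (cong (rowOf (b mu)) n∸d≡1+k) (b-row 1 mu k)) ⟩
      nth [] (insertRow (Jd T (b mu) n d) (replicate (μ k) (suc k))) r
        ≡⟨ Jrow-insert k (Jd T (b mu) n d)
                       (λ r → trans (Jd-rows d (<⇒≤ 1+d≤n) r) (cong (λ k → Jrow k r) n∸d≡1+k)) r ⟩
      Jrow k r
        ∎
      where
      open ≡-Reasoning
      k = n ∸ suc d
      n∸d≡1+k : n ∸ d ≡ suc k
      n∸d≡1+k = +-∸-assoc 1 1+d≤n

    J-rows : ∀ k → k ≤ n → ∀ r → nth [] (J T (b mu) n k) r ≡ Jrow k r
    J-rows k k≤n r = trans (Jd-rows (n ∸ k) (m∸n≤m n k) r) (cong (λ k → Jrow k r) (m∸[m∸n]≡n k≤n))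

    tailSum-J : ∀ k → k ≤ n → ∀ j → tailSum (J T (b mu) n k) (suc j) ≡ sumFrom (length ∘ Jrow k) j n
    tailSum-J k k≤n j = trans
      (sum-map-drop length (J T (b mu) n k) j n λ r j+n≤r →
        cong length (trans (J-rows k k≤n r) (Jrow-empty k (≤-trans (m≤n+m n j) j+n≤r))))
      (sumFrom-cong (cong length ∘ J-rows k k≤n) j n)

    Jrow-telescope : ∀ k r → length (Jrow (suc k) r) + GT T (suc r + suc k) (suc (suc r))
                           ≡ GT T (r + suc k) (suc r) + length (Jrow k (suc r))
    Jrow-telescope k r = begin
      length (Jrow (suc k) r) + a (suc r)
        ≡⟨ cong (_+ a (suc r)) (length-++-replicate (atMost (r + suc k) (row r)) _ _) ⟩
      a r + carried k (suc r) + a (suc r)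
        ≡⟨ +-assoc (a r) _ _ ⟩
      a r + (carried k (suc r) + a (suc r))
        ≡⟨ cong (_+_ (a r)) (+-comm (carried k (suc r)) _) ⟩
      a r + (a (suc r) + carried k (suc r))
        ≡⟨ cong (_+_ (a r)) length-Jrow ⟨
      a r + length (Jrow k (suc r))
        ∎
      where
      open ≡-Reasoning
      a = λ r → GT T (r + suc k) (suc r)
      length-Jrow : length (Jrow k (suc r)) ≡ a (suc r) + carried k (suc r)
      length-Jrow = trans (cong length (Jrow-carried k (suc r)))
                          (length-++-replicate (atMost (suc r + suc k) (row (suc r))) _ _)

    tailSum-J-suc : ∀ k → suc k ≤ n → ∀ j → tailSum (J T (b mu) n (suc k)) (suc j)
                                          ≡ GT T (j + suc k) (suc j) + tailSum (J T (b mu) n k) (suc (suc j))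
    tailSum-J-suc k 1+k≤n j = begin
      tailSum (J T (b mu) n (suc k)) (suc j)
        ≡⟨ tailSum-J (suc k) 1+k≤n j ⟩
      sumFrom (length ∘ Jrow (suc k)) j n
        ≡⟨ sumFrom-telescope (Jrow-telescope k) j n GT≡0 ⟩
      GT T (j + suc k) (suc j) + sumFrom (length ∘ Jrow k) (suc j) n
        ≡⟨ cong (_+_ (GT T (j + suc k) (suc j))) (tailSum-J k (<⇒≤ 1+k≤n) (suc j)) ⟨
      GT T (j + suc k) (suc j) + tailSum (J T (b mu) n k) (suc (suc j))
        ∎
      where
      open ≡-Reasoning
      GT≡0 : GT T (j + n + suc k) (suc (j + n)) ≡ 0
      GT≡0 = cong (length ∘ atMost (j + n + suc k)) (row-empty (m≤n+m n j))

lemma7p7 : (n : ℕ) (la mu : List ℕ) (T : Tableau) →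
    IsPartition n la → IsPartition n mu →
    IsTableau n la T → Dominant n mu T →
    ∀ i j → 1 ≤ j → j ≤ i → i ≤ n → R n T (b mu) i j ≡ + GT T i j
lemma7p7 n la mu T _ (length-mu , mu-sorted) (entries , sorted , columns , length≤n , _) dominant
         i (suc j) _ 1+j≤i i≤n = begin
    R n T (b mu) i (suc j)                        ≡⟨ cong (λ x → + x ℤ.- + B) (tailSum-J-suc k 1+k≤n j) ⟩
    + (GT T (j + suc k) (suc j) + B) ℤ.- + B      ≡⟨ +[m+n]-+n≡+m (GT T (j + suc k) (suc j)) B ⟩
    + GT T (j + suc k) (suc j)                    ≡⟨ cong (λ i → + GT T i (suc j)) j+1+k≡i ⟩
    + GT T i (suc j)                              ∎
  where
  open ≡-Reasoning
  open TableauRows n T (λ r → All.map proj₂ (All-nth [] [] entries r)) (All-nth [] [] sorted)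
                       (λ r → Prefix.map <⇒≤ (Prefix-from-nth (columns r))) length≤n
  open Recording mu length-mu mu-sorted dominant
  k = i ∸ suc j
  B = tailSum (J T (b mu) n k) (suc (suc j))
  j+1+k≡i : j + suc k ≡ i
  j+1+k≡i = trans (+-suc j k) (m+[n∸m]≡n 1+j≤i)
  1+k≤n : suc k ≤ n
  1+k≤n = ≤-trans (m≤n+m (suc k) j) (≤-trans (≤-reflexive j+1+k≡i) i≤n)
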